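{- Let $(D,\le)$ be a continuous domain with a basis $B_D$. For $A\subseteq B_D$ put $\gamma(A)=\{x\in B_D:\exists a\in A,\ x\le a\}$, $\tau(A)=\{x\in B_D:\exists a\in A,\ x\ll a\}$, $\langle A\rangle=\tau(\gamma(A))$, and let $\mathcal{F}_D$ be the family of finite subsets of $B_D$ having a greatest element. A nonempty subset $U\subseteq B_D$ is an $\mathbb{F}$-regular open set of $(B_D,\tau\circ\gamma,\mathcal{F}_D)$ (i.e. for every finite $M\subseteq U$ there is $F\in\mathcal{F}_D$ with $M\subseteq\langle F\rangle\subseteq U$) if and only if: (R1) for all $u\in B_D$ and $v\in U$, $u\ll v$ implies $u\in U$; and (R2) for every finite $M\subseteq U$ there is $u\in U$ with $m\ll u$ for all $m\in M$.
   Context: Way below: $x\ll y$ iff for every directed $S$ with $y\le\bigvee S$ some $s\in S$ satisfies $x\le s$. A basis of a dcpo $D$ is $B_D\subseteq D$ such that every $x\in D$ is the supremum of a directed subset of $\{b\in B_D:b\ll x\}$; a continuous domain is a dcpo with a basis. -}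

module Defs where

open import Level using (Level; _⊔_)
open import Data.Product using (Σ; ∃; _×_; _,_)
open import Data.List using (List)
open import Data.List.Relation.Unary.All using (All)
open import Data.List.Membership.Propositional using (_∈_)
open import Relation.Unary using (Pred; _⊆_)
open import Relation.Binary.Bundles using (Poset)

module _ {c ℓ₁ ℓ₂ : Level} (P : Poset c ℓ₁ ℓ₂) where
  open Poset P renaming (Carrier to D)

  Subset : Set _
  Subset = Pred D c

  Directed : Subset → Set (c ⊔ ℓ₂)
  Directed S = (∃ λ x → S x) × (∀ x y → S x → S y → ∃ λ z → S z × x ≤ z × y ≤ z)

  IsUpperBound : Subset → D → Set (c ⊔ ℓ₂)
  IsUpperBound S u = ∀ x → S x → x ≤ u

  IsSup : Subset → D → Set (c ⊔ ℓ₂)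
  IsSup S s = IsUpperBound S s × (∀ u → IsUpperBound S u → s ≤ u)

  IsDcpo : Set _
  IsDcpo = ∀ (S : Subset) → Directed S → ∃ λ s → IsSup S s

  _≪_ : D → D → Set _
  x ≪ y = ∀ (S : Subset) → Directed S → ∀ s → IsSup S s → y ≤ s → ∃ λ t → S t × x ≤ t

  IsBasis : Subset → Set _
  IsBasis B = ∀ x → Σ Subset λ S → (∀ b → S b → B b × b ≪ x) × Directed S × IsSup S x

  module _ (B : Subset) where
    γ : ∀ {a} → Pred D a → Pred D _
    γ A x = B x × ∃ λ a → A a × x ≤ a

    τ : ∀ {a} → Pred D a → Pred D _
    τ A x = B x × ∃ λ a → A a × x ≪ a

    ⟨_⟩ : ∀ {a} → Pred D a → Pred D _
    ⟨ A ⟩ = τ (γ A)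

    ListSet : List D → Subset
    ListSet F x = x ∈ F

    InFD : List D → Set _
    InFD F = All B F × ∃ λ g → g ∈ F × All (λ f → f ≤ g) F

    FRegularOpen : Subset → Set _
    FRegularOpen U = ∀ (M : List D) → All U M →
      ∃ λ F → InFD F × All ⟨ ListSet F ⟩ M × (⟨ ListSet F ⟩ ⊆ U)

    R1 : Subset → Set _
    R1 U = ∀ u v → B u → U v → u ≪ v → U u

    R2 : Subset → Set _
    R2 U = ∀ (M : List D) → All U M → ∃ λ u → U u × All (λ m → m ≪ u) M

module Submission where

-- The approximants of the approximants of
--     g form a directed set with supremum g, to which the previous fact applies.
--   * The interior ⟨F⟩ of a list F with greatest element g is exactly the set
--     of basis elements way below g; together with the downward closure of ⟨A⟩
--     along ≪ this gives both directions of the theorem, the backward direction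
--     using the singleton [u] supplied by (R2) as the witness in 𝓕_D.

open import Defs hiding (_≪_)
open import Level using (Level)
open import Data.Product using (∃; _×_; _,_; proj₁; proj₂)
open import Relation.Unary using (Pred; _⊆_)
open import Relation.Binary.Bundles using (Poset)
open import Function.Bundles using (_⇔_; mk⇔)
open import Data.List using ([]; _∷_; [_])
open import Data.List.Relation.Unary.All as All using (All; []; _∷_)
open import Data.List.Relation.Unary.Any using (here)
open import Data.List.Membership.Propositional using (_∈_)
open import Relation.Binary.PropositionalEquality using (_≡_; refl)

module WayBelow {c ℓ₁ ℓ₂ : Level} (P : Poset c ℓ₁ ℓ₂) where
  open Poset P renaming (Carrier to D; refl to ≤-refl)

  infix 4 _≪_
  _≪_ : D → D → Set _
  x ≪ y = Defs._≪_ P x y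

  ≪-≤-trans : ∀ {x y z} → x ≪ y → y ≤ z → x ≪ z
  ≪-≤-trans x≪y y≤z S dir s sup z≤s = x≪y S dir s sup (trans y≤z z≤s)

  ≤-≪-trans : ∀ {x y z} → x ≤ y → y ≪ z → x ≪ z
  ≤-≪-trans x≤y y≪z S dir s sup z≤s with y≪z S dir s sup z≤s
  ... | t , St , y≤t = t , St , trans x≤y y≤t

  singleton : D → Subset P
  singleton y z = z ≡ y

  singleton-directed : ∀ y → Directed P (singleton y)
  singleton-directed y = (y , refl) , λ { _ _ refl refl → y , refl , ≤-refl , ≤-refl }

  singleton-sup : ∀ y → IsSup P (singleton y) y
  singleton-sup y = (λ { _ refl → ≤-refl }) , λ u ub → ub y refl

  ≪⇒≤ : ∀ {x y} → x ≪ y → x ≤ y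
  ≪⇒≤ {y = y} x≪y with x≪y (singleton y) (singleton-directed y) y (singleton-sup y) ≤-refl
  ... | _ , refl , x≤y = x≤y

  ≪-sup-bounded : ∀ (T : Subset P) → Directed P T → ∀ {s} → IsSup P T s →
                  ∀ {M} → All (_≪ s) M → ∃ λ t → T t × All (_≤ t) M
  ≪-sup-bounded T (nonempty , _) sup [] = proj₁ nonempty , proj₂ nonempty , []
  ≪-sup-bounded T dir@(_ , upper) sup (m≪s ∷ ms≪s)
    with ≪-sup-bounded T dir sup ms≪s | m≪s T dir _ sup ≤-refl
  ... | t , Tt , ms≤t | t′ , Tt′ , m≤t′ with upper t t′ Tt Tt′
  ... | z , Tz , t≤z , t′≤z = z , Tz , trans m≤t′ t′≤z ∷ All.map (λ p → trans p t≤z) ms≤t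

module Interpolation {c ℓ₁ ℓ₂ : Level} (P : Poset c ℓ₁ ℓ₂) (B : Subset P)
                     (basis : IsBasis P B) where
  open Poset P renaming (Carrier to D; refl to ≤-refl)
  open WayBelow P

  ↡ : D → Subset P
  ↡ x = proj₁ (basis x)

  ↡-basis : ∀ {x b} → ↡ x b → B b
  ↡-basis {x} {b} h = proj₁ (proj₁ (proj₂ (basis x)) b h)

  ↡-≪ : ∀ {x b} → ↡ x b → b ≪ x
  ↡-≪ {x} {b} h = proj₂ (proj₁ (proj₂ (basis x)) b h)

  ↡-directed : ∀ x → Directed P (↡ x)
  ↡-directed x = proj₁ (proj₂ (proj₂ (basis x)))

  ↡-sup : ∀ x → IsSup P (↡ x) x
  ↡-sup x = proj₂ (proj₂ (proj₂ (basis x)))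

  ≪-approximant : ∀ {M x} → All (_≪ x) M → ∃ λ t → ↡ x t × All (_≤ t) M
  ≪-approximant {x = x} = ≪-sup-bounded (↡ x) (↡-directed x) (↡-sup x)

  ↡↡ : D → Subset P
  ↡↡ g b = ∃ λ b′ → ↡ g b′ × ↡ b′ b

  -- Directed: if x ≪ x′ and y ≪ y′ with x′, y′ ∈ ↡ g, take z′ ∈ ↡ g above
  -- both; then x, y ≪ z′ and so are below a common approximant of z′.
  ↡↡-directed : ∀ g → Directed P (↡↡ g)
  ↡↡-directed g = nonempty , upper
    where
    nonempty : ∃ (↡↡ g)
    nonempty with proj₁ (↡-directed g)
    ... | b′ , gb′ with proj₁ (↡-directed b′)
    ... | b , b′b = b , b′ , gb′ , b′b

    upper : ∀ x y → ↡↡ g x → ↡↡ g y → ∃ λ z → ↡↡ g z × x ≤ z × y ≤ z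
    upper x y (x′ , gx′ , x′x) (y′ , gy′ , y′y) with proj₂ (↡-directed g) x′ y′ gx′ gy′
    ... | z′ , gz′ , x′≤z′ , y′≤z′
      with ≪-approximant (≪-≤-trans (↡-≪ x′x) x′≤z′ ∷ ≪-≤-trans (↡-≪ y′y) y′≤z′ ∷ [])
    ... | z , z′z , x≤z ∷ y≤z ∷ [] = z , (z′ , gz′ , z′z) , x≤z , y≤z

  ↡↡-sup : ∀ g → IsSup P (↡↡ g) g
  ↡↡-sup g = below , least
    where
    below : IsUpperBound P (↡↡ g) g
    below x (x′ , gx′ , x′x) = trans (proj₁ (↡-sup x′) x x′x) (proj₁ (↡-sup g) x′ gx′)

    least : ∀ u → IsUpperBound P (↡↡ g) u → g ≤ u
    least u ub = proj₂ (↡-sup g) u λ b′ gb′ →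
                   proj₂ (↡-sup b′) u λ b b′b → ub b (b′ , gb′ , b′b)

  -- Interpolation: finitely many elements way below g are way below a common
  -- basis element b ≪ g.  Bound them by some b ∈ ↡↡ g, tagged by b′ ∈ ↡ g;
  -- then M ≤ b ≪ b′ ≪ g.
  interpolation : ∀ {g M} → All (_≪ g) M → ∃ λ b → B b × b ≪ g × All (_≪ b) M
  interpolation {g} M≪g with ≪-sup-bounded (↡↡ g) (↡↡-directed g) (↡↡-sup g) M≪g
  ... | t , (b′ , gb′ , b′t) , M≤t =
    b′ , ↡-basis gb′ , ↡-≪ gb′ , All.map (λ m≤t → ≤-≪-trans m≤t (↡-≪ b′t)) M≤t

module Interior {c ℓ₁ ℓ₂ : Level} (P : Poset c ℓ₁ ℓ₂) (B : Subset P) where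
  open Poset P renaming (Carrier to D; refl to ≤-refl)
  open WayBelow P

  ⟨⟩-≪-closed : ∀ {a} {A : Pred D a} {u v} → B u → u ≪ v → ⟨_⟩ P B A v → ⟨_⟩ P B A u
  ⟨⟩-≪-closed Bu u≪v (_ , a , γa , v≪a) = Bu , a , γa , ≪-≤-trans u≪v (≪⇒≤ v≪a)

  ⟨⟩-≪-top : ∀ {F g x} → All (_≤ g) F → ⟨_⟩ P B (ListSet P B F) x → x ≪ g
  ⟨⟩-≪-top F≤g (_ , a , (_ , f , f∈F , a≤f) , x≪a) =
    ≪-≤-trans x≪a (trans a≤f (All.lookup F≤g f∈F))

  ≪-top-⟨⟩ : ∀ {F g x} → g ∈ F → B g → B x → x ≪ g → ⟨_⟩ P B (ListSet P B F) x
  ≪-top-⟨⟩ {g = g} g∈F Bg Bx x≪g = Bx , g , (Bg , g , g∈F , ≤-refl) , x≪g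

  singleton-InFD : ∀ {u} → B u → InFD P B [ u ]
  singleton-InFD {u} Bu = Bu ∷ [] , u , here refl , ≤-refl ∷ []

module Characterisation {c ℓ₁ ℓ₂ : Level} (P : Poset c ℓ₁ ℓ₂) (B : Subset P)
                        (basis : IsBasis P B) (U : Subset P) (U⊆B : U ⊆ B) where
  open Poset P using () renaming (refl to ≤-refl)
  open WayBelow P
  open Interpolation P B basis
  open Interior P B

  -- (R1): regularity applied to [v] gives v ∈ ⟨F⟩ ⊆ U, and ⟨F⟩ is ≪-closed.
  regular⇒R1 : FRegularOpen P B U → R1 P B U
  regular⇒R1 regular u v Bu Uv u≪v with regular [ v ] (Uv ∷ [])
  ... | _ , _ , v∈⟨F⟩ ∷ [] , ⟨F⟩⊆U = ⟨F⟩⊆U (⟨⟩-≪-closed Bu u≪v v∈⟨F⟩)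

  -- (R2): M ⊆ ⟨F⟩ makes M way below the greatest element g of F; an
  -- interpolant b ∈ B with M ≪ b ≪ g lies in ⟨F⟩ ⊆ U.
  regular⇒R2 : FRegularOpen P B U → R2 P B U
  regular⇒R2 regular M UM with regular M UM
  ... | F , (BF , g , g∈F , F≤g) , M⊆⟨F⟩ , ⟨F⟩⊆U
    with interpolation (All.map (⟨⟩-≪-top F≤g) M⊆⟨F⟩)
  ... | b , Bb , b≪g , M≪b = b , ⟨F⟩⊆U (≪-top-⟨⟩ g∈F (All.lookup BF g∈F) Bb b≪g) , M≪b

  -- Conversely, for u ∈ U with M ≪ u from (R2), the witness F = [u] works:
  -- ⟨[u]⟩ is the set of basis elements way below u, which contains M and,
  -- by (R1), is contained in U.
  R1-R2⇒regular : R1 P B U × R2 P B U → FRegularOpen P B U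
  R1-R2⇒regular (r1 , r2) M UM with r2 M UM
  ... | u , Uu , M≪u =
    [ u ] , singleton-InFD Bu ,
    All.zipWith (λ (Um , m≪u) → ≪-top-⟨⟩ (here refl) Bu (U⊆B Um) m≪u) (UM , M≪u) ,
    λ {x} x∈⟨u⟩ → r1 x u (proj₁ x∈⟨u⟩) Uu (⟨⟩-≪-top (≤-refl ∷ []) x∈⟨u⟩)
    where
    Bu : B u
    Bu = U⊆B Uu

-- Proposition 3.17.
proposition3p17 : ∀ {c ℓ₁ ℓ₂ : Level} (P : Poset c ℓ₁ ℓ₂) (B : Subset P) →
    IsDcpo P → IsBasis P B →
    (U : Subset P) → U ⊆ B → ∃ U →
    FRegularOpen P B U ⇔ (R1 P B U × R2 P B U)
proposition3p17 P B _ basis U U⊆B _ =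
  mk⇔ (λ regular → regular⇒R1 regular , regular⇒R2 regular) R1-R2⇒regular
  where open Characterisation P B basis U U⊆B
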